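{- Let $m\ge2$. Define numbers $g_t(i)$ for $i\ge1$, $1\le t\le m$ by $g_t(1)=\binom{m+t-1}{m}$ and, for $i\ge 2$, $$g_t(i)=\binom{2mi-m+t-1}{mi}-\sum_{j=1}^{i-1}\sum_{r=1}^mg_r(j)\binom{2m(i-j)+t-r-1}{m(i-j)-1}.$$ Then for every $n\ge1$, $$\overline{f}_m(n)=\binom{2mn-1}{mn}-\sum_{i=1}^{n-1}\sum_{t=1}^mg_t(i)\binom{2m(n-i)+m-t-1}{m(n-i)-1},$$ and $g_m(i)=\overline{f}_m(i)$ for all $i\ge1$.
   Context: $\overline{f}_m(n)$ is the number of fillings of the $2\times mn$ rectangle with $1,\dots,2mn$, each once, with rows increasing left to right, and such that in each column $c\notin\{jm+i:0\le j\le n-1,\ 2\le i\le m\}$ the first-row entry is smaller than the second-row entry (no condition in the other columns). -}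

module Defs where

open import Data.Nat as ℕ using (ℕ; zero; suc; _+_; _*_; _∸_; _≡ᵇ_)
open import Data.Nat.Combinatorics using (_C_)
open import Data.Integer as ℤ using (ℤ; +_)
open import Data.Fin using (Fin; toℕ) renaming (_<_ to _<ᶠ_)
open import Data.Vec using (Vec; lookup)
open import Data.Bool using (if_then_else_)
open import Data.Product using (Σ; _×_; ∃-syntax)
open import Relation.Binary.PropositionalEquality using (_≡_)
open import Relation.Nullary using (¬_)

Σ1 : ℕ → (ℕ → ℤ) → ℤ
Σ1 zero    f = + 0
Σ1 (suc k) f = Σ1 k f ℤ.+ f (suc k)

Cℤ : ℕ → ℕ → ℤ
Cℤ a b = + (a C b)

-- The numbers g_t(i) (m fixed).
-- gStep m i G t : the defining right-hand side for g_t(i), where G r j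
-- is assumed to give g_r(j) for all j < i.

gStep : ℕ → ℕ → (ℕ → ℕ → ℤ) → ℕ → ℤ
gStep m (suc zero) G t = Cℤ (m + t ∸ 1) m
gStep m i          G t =
  Cℤ ((2 * m * i ∸ m) + t ∸ 1) (m * i)
  ℤ.- Σ1 (i ∸ 1) (λ j → Σ1 m (λ r →
        G r j ℤ.* Cℤ ((2 * m * (i ∸ j) + t) ∸ r ∸ 1) (m * (i ∸ j) ∸ 1)))

-- gUpTo m k r j = g_r(j)  for all 1 ≤ j ≤ k  (course-of-values table)
gUpTo : ℕ → ℕ → ℕ → ℕ → ℤ
gUpTo m zero    r j = + 0
gUpTo m (suc k) r j =
  if j ≡ᵇ suc k then gStep m (suc k) (gUpTo m k) r else gUpTo m k r j

g : ℕ → ℕ → ℕ → ℤ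
g m t i = gUpTo m i t i

-- Entries 1,…,2mn are represented by Fin (2mn) (i.e. 0,…,2mn-1, an
-- order-preserving relabelling); rows/columns are 0-indexed, so the
-- 0-indexed column c is the paper's column c+1.

Table : ℕ → ℕ → Set
Table m n = Vec (Vec (Fin (2 * (m * n))) (m * n)) 2

entry : ∀ m n → Table m n → Fin 2 → Fin (m * n) → Fin (2 * (m * n))
entry m n T r c = lookup (lookup T r) c

FreeColumn : (m n : ℕ) → Fin (m * n) → Set
FreeColumn m n c =
  ∃[ j ] ∃[ i ] (j ℕ.< n × 2 ℕ.≤ i × i ℕ.≤ m × suc (toℕ c) ≡ j * m + i)

record IsFilling (m n : ℕ) (T : Table m n) : Set where
  field
    injective  : ∀ r c r′ c′ → entry m n T r c ≡ entry m n T r′ c′ → (r ≡ r′ × c ≡ c′)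
    surjective : ∀ x → ∃[ r ] ∃[ c ] (entry m n T r c ≡ x)
    rowsIncr   : ∀ r c c′ → c <ᶠ c′ → entry m n T r c <ᶠ entry m n T r c′
    columns    : ∀ c → ¬ FreeColumn m n c →
                 entry m n T Data.Fin.zero c <ᶠ entry m n T (Data.Fin.suc Data.Fin.zero) c

-- A filling: the table together with (proof-irrelevant) validity, so that
-- two fillings are equal exactly when their tables are equal.
record Filling (m n : ℕ) : Set where
  constructor filling
  field
    table  : Table m n
    .valid : IsFilling m n table

-- "fbar_m(n) = k" : the fillings are in bijection with Fin k.
open import Function.Bundles using (_↔_)

HasCount : Set → ℕ → Set
HasCount A k = A ↔ Fin k

fbarFormula : ℕ → ℕ → ℤ
fbarFormula m n =
  Cℤ (2 * m * n ∸ 1) (m * n)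
  ℤ.- Σ1 (n ∸ 1) (λ i → Σ1 m (λ t →
        g m t i ℤ.* Cℤ ((2 * m * (n ∸ i) + m) ∸ t ∸ 1) (m * (n ∸ i) ∸ 1)))

-- Reading the values of a filling in increasing order and recording the row of each one turns the
-- filling into a lattice path from (0, 0) to (mn, mn): a right step for the top row, an up step for
-- the bottom row. Rows then increase automatically, and the column condition forbids exactly the up
-- steps (a, b) → (a, b + 1) with b ≡ 0 (mod m) and a ≤ b, so f̄_m(n) counts the paths avoiding them.
-- Classifying all other paths to (X, Y) by their first forbidden step gives
--   C(X + Y, Y) = good(X, Y) + Σ good(a, b) · C(X − a + Y − b − 1, X − a).
-- A good path reaches height jm only to the right of column (j − 1)m, so the forbidden steps that
-- occur are those from the points ((j − 1)m + r, jm), 1 ≤ r ≤ m, whose good-path counts are g_r(j).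
-- For (X, Y) = ((i − 1)m + t, im), after Pascal's rule absorbs the term j = 0, this is the
-- recursion for g_t(i); for t = m and i = n it is the formula for f̄_m(n).
{-# OPTIONS --safe #-}
module Submission where

open import Defs
open import Data.Nat using (ℕ; _≤_)
open import Data.Integer using (+_)
open import Data.Product using (Σ; _×_)
open import Relation.Binary.PropositionalEquality using (_≡_)

open import Data.Bool using (Bool; true; false; not; _∨_; T)
open import Data.Bool.Properties using (T?; T-irrelevant)
open import Data.Empty using (⊥; ⊥-elim; ⊥-elim-irr)
open import Data.Fin using (Fin; zero; suc; toℕ; fromℕ<) renaming (_<_ to _<ᶠ_)
open import Data.Fin.Properties using (+↔⊎; toℕ-injective; toℕ-fromℕ<; toℕ<n)
  renaming (<-cmp to <-cmpᶠ; 0≢1+n to 0≢1+nᶠ)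
open import Data.Integer as ℤ using (ℤ)
import Data.Integer.Properties as ℤ
open import Data.Nat
open import Data.Nat.Combinatorics using (_C_; nCk+nC[k+1]≡[n+1]C[k+1]; nCn≡1)
open import Data.Nat.DivMod
  using (_%_; _/_; [m+kn]%n≡m%n; m<n⇒m%n≡m; m*n%n≡0; m%n<n; m<n*o⇒m/o<n; m≡m%n+[m/n]*n)
open import Data.Nat.Induction using (<-rec)
open import Data.Nat.Properties
open import Algebra.Properties.CommutativeSemigroup +-commutativeSemigroup
  using (interchange; xy∙z≈xz∙y; x∙yz≈y∙xz; x∙yz≈xz∙y; x∙yz≈yx∙z; xy∙z≈x∙zy)
open import Data.Nat.Solver using (module +-*-Solver)
open import Data.Product using (∃-syntax; _,_; proj₁; proj₂)
open import Data.Sum using (_⊎_; inj₁; inj₂)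
open import Data.Sum.Function.Propositional using (_⊎-↔_)
open import Data.Vec using (Vec; []; _∷_; lookup; map; tabulate)
open import Data.Vec.Properties using (lookup-map; lookup∘tabulate)
open import Data.Vec.Relation.Binary.Pointwise.Extensional using (ext; Pointwise-≡⇒≡)
open import Function.Base using (_∘_)
open import Function.Bundles using (_↔_; mk↔ₛ′)
open import Function.Properties.Inverse using (↔-trans; ↔-sym)
open import Relation.Binary.Definitions using (tri<; tri≈; tri>)
open import Relation.Binary.PropositionalEquality
open import Relation.Nullary using (¬_; Dec; yes; no; contradiction)
open import Relation.Nullary.Decidable using (recompute; decidable-stable)

open ≡-Reasoning
open +-*-Solver using (solve; _:=_; _:+_; _:*_; con)

sum< : ℕ → (ℕ → ℕ) → ℕ
sum< zero    f = 0
sum< (suc n) f = sum< n f + f n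

sum<-cong : ∀ n {f g : ℕ → ℕ} → (∀ i → i < n → f i ≡ g i) → sum< n f ≡ sum< n g
sum<-cong zero    f≡g = refl
sum<-cong (suc n) f≡g = cong₂ _+_ (sum<-cong n (λ i i<n → f≡g i (m<n⇒m<1+n i<n))) (f≡g n ≤-refl)

sum<-zero : ∀ n {f : ℕ → ℕ} → (∀ i → i < n → f i ≡ 0) → sum< n f ≡ 0
sum<-zero zero    f≡0 = refl
sum<-zero (suc n) f≡0 =
  cong₂ _+_ (sum<-zero n (λ i i<n → f≡0 i (m<n⇒m<1+n i<n))) (f≡0 n ≤-refl)

sum<-+ : ∀ n (f g : ℕ → ℕ) → sum< n (λ i → f i + g i) ≡ sum< n f + sum< n g
sum<-+ zero    f g = refl
sum<-+ (suc n) f g rewrite sum<-+ n f g = interchange (sum< n f) (sum< n g) (f n) (g n)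

sum<-comm : ∀ n k (f : ℕ → ℕ → ℕ) →
            sum< n (λ a → sum< k (f a)) ≡ sum< k (λ b → sum< n (λ a → f a b))
sum<-comm zero    k f = sym (sum<-zero k (λ _ _ → refl))
sum<-comm (suc n) k f = begin
  sum< n (λ a → sum< k (f a)) + sum< k (f n)         ≡⟨ cong (_+ sum< k (f n)) (sum<-comm n k f) ⟩
  sum< k (λ b → sum< n (λ a → f a b)) + sum< k (f n) ≡⟨ sum<-+ k _ (f n) ⟨
  sum< k (λ b → sum< (suc n) (λ a → f a b))          ∎

sum<-++ : ∀ p q (f : ℕ → ℕ) → sum< (p + q) f ≡ sum< p f + sum< q (λ i → f (p + i))
sum<-++ p zero    f rewrite +-identityʳ p = sym (+-identityʳ _)
sum<-++ p (suc q) f rewrite +-suc p q | sum<-++ p q f = +-assoc (sum< p f) _ _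

sum<-suc : ∀ n (f : ℕ → ℕ) → sum< (suc n) f ≡ f 0 + sum< n (λ i → f (suc i))
sum<-suc = sum<-++ 1

sum<-* : ∀ n k (f : ℕ → ℕ) → sum< (n * k) f ≡ sum< n (λ j → sum< k (λ r → f (j * k + r)))
sum<-* zero    k f = refl
sum<-* (suc n) k f rewrite +-comm k (n * k) | sum<-++ (n * k) k f | sum<-* n k f = refl

χ : Bool → ℕ → ℕ
χ true  n = n
χ false n = 0

χ-zero : ∀ c → χ c 0 ≡ 0
χ-zero true  = refl
χ-zero false = refl

χ-+ : ∀ c p q → χ c (p + q) ≡ χ c p + χ c q
χ-+ true  p q = refl
χ-+ false p q = refl

χ-comm : ∀ c d n → χ c (χ d n) ≡ χ d (χ c n)
χ-comm true  d     n = refl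
χ-comm false true  n = refl
χ-comm false false n = refl

χ+χ-not : ∀ c n → χ c n + χ (not c) n ≡ n
χ+χ-not true  n = +-identityʳ n
χ+χ-not false n = refl

allPaths : ℕ → ℕ → ℕ
allPaths zero    w       = 1
allPaths (suc u) zero    = 1
allPaths (suc u) (suc w) = allPaths u (suc w) + allPaths (suc u) w

allPaths-zero : ∀ u → allPaths u 0 ≡ 1
allPaths-zero zero    = refl
allPaths-zero (suc u) = refl

allPaths≡C : ∀ u w → allPaths u w ≡ (u + w) C w
allPaths≡C zero    w       = sym (nCn≡1 w)
allPaths≡C (suc u) zero    = refl
allPaths≡C (suc u) (suc w) = begin
  allPaths u (suc w) + allPaths (suc u) w ≡⟨ cong₂ _+_ (allPaths≡C u (suc w)) (allPaths≡C (suc u) w) ⟩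
  (u + suc w) C suc w + (suc u + w) C w   ≡⟨ cong (λ k → (u + suc w) C suc w + k C w) (+-suc u w) ⟨
  (u + suc w) C suc w + (u + suc w) C w   ≡⟨ +-comm ((u + suc w) C suc w) _ ⟩
  (u + suc w) C w + (u + suc w) C suc w   ≡⟨ nCk+nC[k+1]≡[n+1]C[k+1] (u + suc w) w ⟩
  suc (u + suc w) C suc w                 ∎

module RestrictedColumns (restricted : ℕ → Bool) where

  -- In state (a, b) the a + b smallest values are placed, a in the top row and b in the bottom row.
  -- The next value may go below column b unless b is restricted and its top entry is still missing.
  allowed : ℕ → ℕ → Bool
  allowed a b = not (restricted b) ∨ (b <ᵇ a)

  allowed-unrestricted : ∀ a {b} → restricted b ≡ false → allowed a b ≡ true
  allowed-unrestricted a e rewrite e = refl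

  allowed-late : ∀ {a b} → b < a → allowed a b ≡ true
  allowed-late {a} {b} b<a with restricted b | b <ᵇ a | <⇒<ᵇ b<a
  ... | true  | true | _ = refl
  ... | false | _    | _ = refl

  forbidden : ∀ {a b} → T (restricted b) → a ≤ b → allowed a b ≡ false
  forbidden {a} {b} r a≤b with restricted b | b <ᵇ a | <ᵇ⇒< b a
  ... | true | false | _   = refl
  ... | true | true  | b<a = contradiction a≤b (<⇒≱ (b<a _))

  allowed⇒late : ∀ {a b} → T (allowed a b) → T (restricted b) → b < a
  allowed⇒late {a} {b} ok r with restricted b
  ... | true = <ᵇ⇒< b a ok

  late⇒allowed : ∀ {a b} → (T (restricted b) → b < a) → T (allowed a b)
  late⇒allowed {a} {b} late with restricted b
  ... | true  = <⇒<ᵇ (late _)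
  ... | false = _

  paths : ℕ → ℕ → ℕ → ℕ → ℕ
  paths a b zero    zero    = 1
  paths a b (suc x) zero    = paths (suc a) b x zero
  paths a b zero    (suc y) = χ (allowed a b) (paths a (suc b) zero y)
  paths a b (suc x) (suc y) = paths (suc a) b x (suc y) + χ (allowed a b) (paths a (suc b) (suc x) y)

  paths-right : ∀ a b x → paths a b x 0 ≡ 1
  paths-right a b zero    = refl
  paths-right a b (suc x) = paths-right (suc a) b x

  paths-up : ∀ a b y → paths a b 0 (suc y) ≡ χ (allowed a (b + y)) (paths a b 0 y)
  paths-up a b zero    rewrite +-identityʳ b = refl
  paths-up a b (suc y) rewrite paths-up a (suc b) y | +-suc b y =
    χ-comm (allowed a b) (allowed a (suc (b + y))) _

  paths-last : ∀ a b x y → paths a b (suc x) (suc y) ≡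
               paths a b x (suc y) + χ (allowed (a + suc x) (b + y)) (paths a b (suc x) y)
  paths-last a b zero zero rewrite +-identityʳ b | +-comm a 1 = +-comm (χ (allowed (suc a) b) 1) _
  paths-last a b zero (suc y)
    rewrite paths-up (suc a) b (suc y) | paths-last a (suc b) 0 y | +-suc b y | +-comm a 1
    = exchange (allowed (suc a) (suc (b + y))) (allowed a b) _ _ _
    where
    exchange : ∀ c d p q r → χ c p + χ d (q + χ c r) ≡ χ d q + χ c (p + χ d r)
    exchange c d p q r rewrite χ-+ d q (χ c r) | χ-+ c p (χ d r) | χ-comm c d r =
      x∙yz≈y∙xz (χ c p) (χ d q) (χ d (χ c r))
  paths-last a b (suc x) zero
    rewrite paths-last (suc a) b x 0 | +-suc a (suc x)
          | paths-right (suc a) b (suc x) | paths-right a (suc b) (suc (suc x))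
          | paths-right a (suc b) (suc x)
    = xy∙z≈xz∙y (paths (suc a) b x 1) _ _
  paths-last a b (suc x) (suc y)
    rewrite paths-last (suc a) b x (suc y) | paths-last a (suc b) (suc x) y | +-suc a (suc x) | +-suc b y
    = exchange (allowed (suc (a + suc x)) (suc (b + y))) (allowed a b) _ _ _ _
    where
    exchange : ∀ c d p q r s → (p + χ c q) + χ d (r + χ c s) ≡ (p + χ d r) + χ c (q + χ d s)
    exchange c d p q r s rewrite χ-+ d r (χ c s) | χ-+ c q (χ d s) | χ-comm c d s =
      interchange p (χ c q) (χ d r) (χ d (χ c s))

  good : ℕ → ℕ → ℕ
  good = paths 0 0

  good-up : ∀ y → good 0 (suc y) ≡ χ (allowed 0 y) (good 0 y)
  good-up = paths-up 0 0

  good-last : ∀ x y → good (suc x) (suc y) ≡ good x (suc y) + χ (allowed (suc x) y) (good (suc x) y)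
  good-last = paths-last 0 0

  good-unreachable : ∀ {c} → T (restricted c) → ∀ a b → c < b → a ≤ c → good a b ≡ 0
  upStep-unreachable : ∀ {c} → T (restricted c) → ∀ a b → c < suc b → a ≤ c →
                       χ (allowed a b) (good a b) ≡ 0

  good-unreachable r zero    (suc b) c<1+b a≤c = trans (good-up b) (upStep-unreachable r 0 b c<1+b a≤c)
  good-unreachable r (suc a) (suc b) c<1+b a<c =
    trans (good-last a b) (cong₂ _+_ (good-unreachable r a (suc b) c<1+b (<⇒≤ a<c))
                                     (upStep-unreachable r (suc a) b c<1+b a<c))

  upStep-unreachable r a b c<1+b a≤c with m<1+n⇒m<n∨m≡n c<1+b
  ... | inj₁ c<b  = trans (cong (χ _) (good-unreachable r a b c<b a≤c)) (χ-zero _)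
  ... | inj₂ refl = cong (λ ok → χ ok (good a b)) (forbidden r a≤c)

  blocked : ℕ → ℕ → ℕ
  blocked a b = χ (not (allowed a b)) (good a b)

  blocked-allowed : ∀ {a b} → allowed a b ≡ true → blocked a b ≡ 0
  blocked-allowed ok rewrite ok = refl

  blocked-forbidden : ∀ {a b} → T (restricted b) → a ≤ b → blocked a b ≡ good a b
  blocked-forbidden r a≤b rewrite forbidden r a≤b = refl

  -- A path to (x, y) that is not good is a good path to some (a, b), a forbidden step
  -- (a, b) → (a, b + 1), and an arbitrary path on to (x, y); violations x y counts them by a.
  violationsFrom : ℕ → ℕ → ℕ → ℕ
  violationsFrom a u y = sum< y (λ b → blocked a b * allPaths u (y ∸ suc b))

  violations : ℕ → ℕ → ℕ
  violations x y = sum< (suc x) (λ a → violationsFrom a (x ∸ a) y)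

  violationsFrom-pascal : ∀ a u y →
    violationsFrom a (suc u) (suc y) ≡ violationsFrom a u (suc y) + violationsFrom a (suc u) y
  violationsFrom-pascal a u y = begin
    sum< y (λ b → blocked a b * allPaths (suc u) (y ∸ b)) + blocked a y * allPaths (suc u) (y ∸ y)
      ≡⟨ cong₂ _+_ (trans (sum<-cong y pascal-term) (sum<-+ y _ _)) (cong (blocked a y *_) (last-term u)) ⟩
    (sum< y (λ b → blocked a b * allPaths u (y ∸ b)) + violationsFrom a (suc u) y)
      + blocked a y * allPaths u (y ∸ y)
      ≡⟨ xy∙z≈xz∙y (sum< y (λ b → blocked a b * allPaths u (y ∸ b))) _ _ ⟩
    violationsFrom a u (suc y) + violationsFrom a (suc u) y ∎
    where
    pascal-term : ∀ b → b < y → blocked a b * allPaths (suc u) (y ∸ b) ≡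
                  blocked a b * allPaths u (y ∸ b) + blocked a b * allPaths (suc u) (y ∸ suc b)
    pascal-term b b<y rewrite +-∸-assoc 1 b<y = *-distribˡ-+ (blocked a b) _ _
    last-term : ∀ u → allPaths (suc u) (y ∸ y) ≡ allPaths u (y ∸ y)
    last-term u rewrite n∸n≡0 y = sym (allPaths-zero u)

  violations-pascal : ∀ x y →
    violations (suc x) (suc y) ≡ (violations x (suc y) + violations (suc x) y) + blocked (suc x) y
  violations-pascal x y = begin
    sum< (suc x) (λ a → violationsFrom a (suc x ∸ a) (suc y)) + violationsFrom (suc x) (x ∸ x) (suc y)
      ≡⟨ cong₂ _+_ (trans (sum<-cong (suc x) earlier-column) (sum<-+ (suc x) _ _)) last-column ⟩
    (violations x (suc y) + A) + (L + blocked (suc x) y)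
      ≡⟨ +-assoc (violations x (suc y) + A) L _ ⟨
    ((violations x (suc y) + A) + L) + blocked (suc x) y
      ≡⟨ cong (_+ blocked (suc x) y) (+-assoc (violations x (suc y)) A L) ⟩
    (violations x (suc y) + violations (suc x) y) + blocked (suc x) y ∎
    where
    A L : ℕ
    A = sum< (suc x) (λ a → violationsFrom a (suc x ∸ a) y)
    L = violationsFrom (suc x) (x ∸ x) y
    earlier-column : ∀ a → a < suc x → violationsFrom a (suc x ∸ a) (suc y) ≡
                     violationsFrom a (x ∸ a) (suc y) + violationsFrom a (suc x ∸ a) y
    earlier-column a a<1+x rewrite +-∸-assoc 1 (≤-pred a<1+x) = violationsFrom-pascal a (x ∸ a) y
    last-column : violationsFrom (suc x) (x ∸ x) (suc y) ≡
                  violationsFrom (suc x) (x ∸ x) y + blocked (suc x) y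
    last-column rewrite n∸n≡0 x = cong (_+_ (violationsFrom (suc x) 0 y)) (*-identityʳ (blocked (suc x) y))

  allPaths≡good+violations : ∀ x y → allPaths x y ≡ good x y + violations x y
  allPaths≡good+violations x zero
    rewrite allPaths-zero x | paths-right 0 0 x | sum<-zero (suc x) (λ _ _ → refl) = refl
  allPaths≡good+violations zero (suc y) = begin
    1                                       ≡⟨ allPaths≡good+violations 0 y ⟩
    good 0 y + violations 0 y               ≡⟨ cong (_+ violations 0 y) (χ+χ-not (allowed 0 y) (good 0 y)) ⟨
    (lastUp + blocked 0 y) + violations 0 y ≡⟨ xy∙z≈x∙zy lastUp (blocked 0 y) (violations 0 y) ⟩
    lastUp + (violations 0 y + blocked 0 y)
      ≡⟨ cong₂ _+_ (good-up y) (cong (_+_ (violations 0 y)) (*-identityʳ (blocked 0 y))) ⟨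
    good 0 (suc y) + violations 0 (suc y)   ∎
    where
    lastUp : ℕ
    lastUp = χ (allowed 0 y) (good 0 y)
  allPaths≡good+violations (suc x) (suc y) = begin
    allPaths x (suc y) + allPaths (suc x) y
      ≡⟨ cong₂ _+_ (allPaths≡good+violations x (suc y)) (allPaths≡good+violations (suc x) y) ⟩
    (good x (suc y) + violations x (suc y)) + (good (suc x) y + violations (suc x) y)
      ≡⟨ cong (λ g → (good x (suc y) + violations x (suc y)) + (g + violations (suc x) y))
              (χ+χ-not (allowed (suc x) y) (good (suc x) y)) ⟨
    (good x (suc y) + violations x (suc y)) + ((lastUp + blocked (suc x) y) + violations (suc x) y)
      ≡⟨ regroup (good x (suc y)) (violations x (suc y)) lastUp (blocked (suc x) y) (violations (suc x) y) ⟩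
    (good x (suc y) + lastUp) + ((violations x (suc y) + violations (suc x) y) + blocked (suc x) y)
      ≡⟨ cong₂ _+_ (good-last x y) (violations-pascal x y) ⟨
    good (suc x) (suc y) + violations (suc x) (suc y) ∎
    where
    lastUp : ℕ
    lastUp = χ (allowed (suc x) y) (good (suc x) y)
    regroup : ∀ g v h b w → (g + v) + ((h + b) + w) ≡ (g + h) + ((v + w) + b)
    regroup = solve 5 (λ g v h b w → (g :+ v) :+ ((h :+ b) :+ w) := (g :+ h) :+ ((v :+ w) :+ b)) refl

T×-↔ : ∀ c {A : Set} {n} → A ↔ Fin n → (T c × A) ↔ Fin (χ c n)
T×-↔ true  A↔n = ↔-trans (mk↔ₛ′ proj₂ (_ ,_) (λ _ → refl) (λ _ → refl)) A↔n
T×-↔ false _   = mk↔ₛ′ (λ { (() , _) }) (λ ()) (λ ()) (λ { (() , _) })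

module PathEncoding (restricted : ℕ → Bool) where
  open RestrictedColumns restricted

  private variable
    a b x y h : ℕ
    r₀ : Vec ℕ x
    r₁ : Vec ℕ y

  data Fill (a b : ℕ) : {x y : ℕ} → Vec ℕ x → Vec ℕ y → Set where
    done   : Fill a b [] []
    top    : Fill (suc a) b r₀ r₁ → Fill a b ((a + b) ∷ r₀) r₁
    bottom : T (allowed a b) → Fill a (suc b) r₀ r₁ → Fill a b r₀ ((a + b) ∷ r₁)

  record Filled (a b x y : ℕ) : Set where
    constructor filled
    field
      upper : Vec ℕ x
      lower : Vec ℕ y
      .fill : Fill a b upper lower

  private
    bump : ∀ {z} → a + suc b ≤ z → a + b < z
    bump {a} {b} {z} = subst (_≤ z) (+-suc a b)

  Fill-upper-≥ : Fill a b r₀ r₁ → ∀ i → a + b ≤ lookup r₀ i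
  Fill-upper-≥ (top p)      zero    = ≤-refl
  Fill-upper-≥ (top p)      (suc i) = <⇒≤ (Fill-upper-≥ p i)
  Fill-upper-≥ (bottom _ p) i       = <⇒≤ (bump (Fill-upper-≥ p i))

  Fill-lower-≥ : Fill a b r₀ r₁ → ∀ i → a + b ≤ lookup r₁ i
  Fill-lower-≥ (top p)      i       = <⇒≤ (Fill-lower-≥ p i)
  Fill-lower-≥ (bottom _ p) zero    = ≤-refl
  Fill-lower-≥ (bottom _ p) (suc i) = <⇒≤ (bump (Fill-lower-≥ p i))

  Fill-top⁻¹ : Fill a b (h ∷ r₀) r₁ → h ≡ a + b → Fill (suc a) b r₀ r₁
  Fill-top⁻¹ (top p)      _   = p
  Fill-top⁻¹ (bottom _ p) h≡n = ⊥-elim (<⇒≢ (bump (Fill-upper-≥ p zero)) (sym h≡n))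

  Fill-top-only : Fill a b (h ∷ r₀) [] → h ≡ a + b
  Fill-top-only (top p) = refl

  TopNext : ∀ {x} → ℕ → ℕ → Vec ℕ x → Set
  TopNext a b []      = ⊥
  TopNext a b (h ∷ _) = h ≡ a + b

  Fill-bottom-head : Fill a b r₀ (h ∷ r₁) → ¬ TopNext a b r₀ → h ≡ a + b
  Fill-bottom-head (top p)      ¬next = ⊥-elim (¬next refl)
  Fill-bottom-head (bottom _ p) _     = refl

  Fill-bottom-allowed : Fill a b r₀ (h ∷ r₁) → ¬ TopNext a b r₀ → T (allowed a b)
  Fill-bottom-allowed (top p)       ¬next = ⊥-elim (¬next refl)
  Fill-bottom-allowed (bottom ok p) _     = ok

  Fill-bottom⁻¹ : Fill a b r₀ (h ∷ r₁) → ¬ TopNext a b r₀ → Fill a (suc b) r₀ r₁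
  Fill-bottom⁻¹ (top p)      ¬next = ⊥-elim (¬next refl)
  Fill-bottom⁻¹ (bottom _ p) _     = p

  Filled-top : ∀ a b x → Filled a b (suc x) 0 ↔ Filled (suc a) b x 0
  Filled-top a b x = mk↔ₛ′ to from (λ { (filled r₀ [] p) → refl }) from∘to
    where
    to : Filled a b (suc x) 0 → Filled (suc a) b x 0
    to (filled (h ∷ r₀) [] p) = filled r₀ [] (Fill-top⁻¹ p (Fill-top-only p))
    from : Filled (suc a) b x 0 → Filled a b (suc x) 0
    from (filled r₀ [] p) = filled ((a + b) ∷ r₀) [] (top p)
    from∘to : ∀ f → from (to f) ≡ f
    from∘to (filled (h ∷ r₀) [] p) with recompute (h ≟ a + b) (Fill-top-only p)
    ... | refl = refl

  Filled-bottom : ∀ a b y → Filled a b 0 (suc y) ↔ (T (allowed a b) × Filled a (suc b) 0 y)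
  Filled-bottom a b y = mk↔ₛ′ to from to∘from from∘to
    where
    to : Filled a b 0 (suc y) → T (allowed a b) × Filled a (suc b) 0 y
    to (filled [] (h ∷ r₁) p) =
      recompute (T? _) (Fill-bottom-allowed p λ ()) , filled [] r₁ (Fill-bottom⁻¹ p λ ())
    from : T (allowed a b) × Filled a (suc b) 0 y → Filled a b 0 (suc y)
    from (t , filled [] r₁ p) = filled [] ((a + b) ∷ r₁) (bottom t p)
    to∘from : ∀ f → to (from f) ≡ f
    to∘from (t , filled [] r₁ p) = cong (_, filled [] r₁ p) (T-irrelevant _ _)
    from∘to : ∀ f → from (to f) ≡ f
    from∘to (filled [] (h ∷ r₁) p) with recompute (h ≟ a + b) (Fill-bottom-head p λ ())
    ... | refl = refl

  Filled-split : ∀ a b x y →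
    Filled a b (suc x) (suc y) ↔ (Filled (suc a) b x (suc y) ⊎ (T (allowed a b) × Filled a (suc b) (suc x) y))
  Filled-split a b x y = mk↔ₛ′ to from to∘from from∘to
    where
    Split = Filled (suc a) b x (suc y) ⊎ (T (allowed a b) × Filled a (suc b) (suc x) y)
    to′ : ∀ {h₀ h₁} {r₀ : Vec ℕ x} {r₁ : Vec ℕ y} →
          .(Fill a b (h₀ ∷ r₀) (h₁ ∷ r₁)) → Dec (h₀ ≡ a + b) → Split
    to′ {r₀ = r₀} {r₁} p (yes h≡n) = inj₁ (filled r₀ _ (Fill-top⁻¹ p h≡n))
    to′ {h₀} {r₀ = r₀} {r₁} p (no h≢n) =
      inj₂ (recompute (T? _) (Fill-bottom-allowed p h≢n) , filled (h₀ ∷ r₀) r₁ (Fill-bottom⁻¹ p h≢n))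
    to : Filled a b (suc x) (suc y) → Split
    to (filled (h₀ ∷ r₀) (h₁ ∷ r₁) p) = to′ p (h₀ ≟ a + b)
    from : Split → Filled a b (suc x) (suc y)
    from (inj₁ (filled r₀ r₁ p))     = filled ((a + b) ∷ r₀) r₁ (top p)
    from (inj₂ (t , filled r₀ r₁ p)) = filled r₀ ((a + b) ∷ r₁) (bottom t p)
    to∘from : ∀ s → to (from s) ≡ s
    to∘from (inj₁ (filled r₀ (h₁ ∷ r₁) p)) rewrite ≟-diag (refl {x = a + b}) = refl
    to∘from (inj₂ (t , filled (h₀ ∷ r₀) r₁ p)) with h₀ ≟ a + b
    ... | yes h≡n = ⊥-elim-irr (<⇒≢ (bump (Fill-upper-≥ p zero)) (sym h≡n))
    ... | no  _   = cong (λ t → inj₂ (t , filled (h₀ ∷ r₀) r₁ p)) (T-irrelevant _ _)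
    from∘to : ∀ f → from (to f) ≡ f
    from∘to (filled (h₀ ∷ r₀) (h₁ ∷ r₁) p) with h₀ ≟ a + b
    ... | yes refl = refl
    ... | no  h≢n with recompute (h₁ ≟ a + b) (Fill-bottom-head p h≢n)
    ...   | refl = refl

  Filled↔paths : ∀ a b x y → Filled a b x y ↔ Fin (paths a b x y)
  Filled↔paths a b zero    zero    =
    mk↔ₛ′ (λ _ → zero) (λ _ → filled [] [] done) (λ { zero → refl }) (λ { (filled [] [] _) → refl })
  Filled↔paths a b (suc x) zero    = ↔-trans (Filled-top a b x) (Filled↔paths (suc a) b x zero)
  Filled↔paths a b zero    (suc y) =
    ↔-trans (Filled-bottom a b y) (T×-↔ (allowed a b) (Filled↔paths a (suc b) zero y))
  Filled↔paths a b (suc x) (suc y) =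
    ↔-trans (Filled-split a b x y)
      (↔-trans (Filled↔paths (suc a) b x (suc y) ⊎-↔ T×-↔ (allowed a b) (Filled↔paths a (suc b) (suc x) y))
        (↔-sym +↔⊎))

  Occurs : Vec ℕ x → Vec ℕ y → ℕ → Set
  Occurs r₀ r₁ v = (∃[ i ] lookup r₀ i ≡ v) ⊎ (∃[ j ] lookup r₁ j ≡ v)

  -- Entry i of r₀ lies in column a + i and entry j of r₁ in column b + j. A top entry in a column
  -- below a was placed earlier, so it is smaller than all entries of r₁.
  record IsFillingFrom (a b : ℕ) {x y : ℕ} (r₀ : Vec ℕ x) (r₁ : Vec ℕ y) : Set where
    field
      upper-incr : ∀ i j → i <ᶠ j → lookup r₀ i < lookup r₀ j
      lower-incr : ∀ i j → i <ᶠ j → lookup r₁ i < lookup r₁ j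
      upper-≥    : ∀ i → a + b ≤ lookup r₀ i
      lower-≥    : ∀ j → a + b ≤ lookup r₁ j
      upper-<    : ∀ i → lookup r₀ i < a + b + (x + y)
      lower-<    : ∀ j → lookup r₁ j < a + b + (x + y)
      disjoint   : ∀ i j → lookup r₀ i ≢ lookup r₁ j
      covers     : ∀ v → a + b ≤ v → v < a + b + (x + y) → Occurs r₀ r₁ v
      columns    : ∀ j → T (restricted (b + toℕ j)) →
                   b + toℕ j < a ⊎ ∃[ i ] (a + toℕ i ≡ b + toℕ j × lookup r₀ i < lookup r₁ j)

  private
    end-top : ∀ a b x y → a + b + (suc x + y) ≡ suc a + b + (x + y)
    end-top a b x y = +-suc (a + b) (x + y)

    end-bottom : ∀ a b x y → a + b + (x + suc y) ≡ a + suc b + (x + y)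
    end-bottom a b x y = begin
      a + b + (x + suc y)   ≡⟨ cong (_+_ (a + b)) (+-suc x y) ⟩
      a + b + suc (x + y)   ≡⟨ +-suc (a + b) (x + y) ⟩
      suc (a + b + (x + y)) ≡⟨ cong (_+ (x + y)) (+-suc a b) ⟨
      a + suc b + (x + y)   ∎

  IsFillingFrom-[] : ∀ a b → IsFillingFrom a b [] []
  IsFillingFrom-[] a b = record
    { upper-incr = λ () ; lower-incr = λ () ; upper-≥ = λ () ; lower-≥ = λ ()
    ; upper-< = λ () ; lower-< = λ () ; disjoint = λ () ; columns = λ ()
    ; covers = λ v lo hi → ⊥-elim (<⇒≱ hi (subst (_≤ v) (sym (+-identityʳ (a + b))) lo)) }

  IsFillingFrom-top : ∀ {a b x y} {r₀ : Vec ℕ x} {r₁ : Vec ℕ y} →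
    IsFillingFrom (suc a) b r₀ r₁ → IsFillingFrom a b ((a + b) ∷ r₀) r₁
  IsFillingFrom-top {a} {b} {x} {y} {r₀} {r₁} F = record
    { upper-incr = incr ; lower-incr = lower-incr ; upper-≥ = above ; lower-≥ = λ j → <⇒≤ (lower-≥ j)
    ; upper-< = below ; lower-< = λ j → subst (lookup r₁ j <_) (sym (end-top a b x y)) (lower-< j)
    ; disjoint = apart ; covers = cover ; columns = column }
    where
    open IsFillingFrom F
    r₀′ = (a + b) ∷ r₀
    incr : ∀ i j → i <ᶠ j → lookup r₀′ i < lookup r₀′ j
    incr zero    (suc j) _         = upper-≥ j
    incr (suc i) (suc j) (s≤s i<j) = upper-incr i j i<j
    above : ∀ i → a + b ≤ lookup r₀′ i
    above zero    = ≤-refl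
    above (suc i) = <⇒≤ (upper-≥ i)
    below : ∀ i → lookup r₀′ i < a + b + (suc x + y)
    below zero    = subst (a + b <_) (sym (end-top a b x y)) (s≤s (m≤m+n (a + b) (x + y)))
    below (suc i) = subst (lookup r₀ i <_) (sym (end-top a b x y)) (upper-< i)
    apart : ∀ i j → lookup r₀′ i ≢ lookup r₁ j
    apart zero    j = <⇒≢ (lower-≥ j)
    apart (suc i) j = disjoint i j
    cover : ∀ v → a + b ≤ v → v < a + b + (suc x + y) → Occurs r₀′ r₁ v
    cover v lo hi with m≤n⇒m<n∨m≡n lo
    ... | inj₂ n≡v = inj₁ (zero , n≡v)
    ... | inj₁ n<v with covers v n<v (subst (v <_) (end-top a b x y) hi)
    ...   | inj₁ (i , e) = inj₁ (suc i , e)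
    ...   | inj₂ found   = inj₂ found
    column : ∀ j → T (restricted (b + toℕ j)) →
             b + toℕ j < a ⊎ ∃[ i ] (a + toℕ i ≡ b + toℕ j × lookup r₀′ i < lookup r₁ j)
    column j r with columns j r
    ... | inj₂ (i , same , lt) = inj₂ (suc i , trans (+-suc a (toℕ i)) same , lt)
    ... | inj₁ lt with m<1+n⇒m<n∨m≡n lt
    ...   | inj₁ lt′  = inj₁ lt′
    ...   | inj₂ same = inj₂ (zero , trans (+-identityʳ a) (sym same) , lower-≥ j)

  IsFillingFrom-bottom : ∀ {a b x y} {r₀ : Vec ℕ x} {r₁ : Vec ℕ y} →
    T (allowed a b) → IsFillingFrom a (suc b) r₀ r₁ → IsFillingFrom a b r₀ ((a + b) ∷ r₁)
  IsFillingFrom-bottom {a} {b} {x} {y} {r₀} {r₁} ok F = record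
    { upper-incr = upper-incr ; lower-incr = incr
    ; upper-≥ = λ i → <⇒≤ (bump (upper-≥ i)) ; lower-≥ = above
    ; upper-< = λ i → subst (lookup r₀ i <_) (sym (end-bottom a b x y)) (upper-< i) ; lower-< = below
    ; disjoint = apart ; covers = cover ; columns = column }
    where
    open IsFillingFrom F
    r₁′ = (a + b) ∷ r₁
    incr : ∀ i j → i <ᶠ j → lookup r₁′ i < lookup r₁′ j
    incr zero    (suc j) _         = bump (lower-≥ j)
    incr (suc i) (suc j) (s≤s i<j) = lower-incr i j i<j
    above : ∀ j → a + b ≤ lookup r₁′ j
    above zero    = ≤-refl
    above (suc j) = <⇒≤ (bump (lower-≥ j))
    below : ∀ j → lookup r₁′ j < a + b + (x + suc y)
    below zero    = subst (a + b <_) (sym (trans (cong (_+_ (a + b)) (+-suc x y)) (+-suc (a + b) (x + y))))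
                          (s≤s (m≤m+n (a + b) (x + y)))
    below (suc j) = subst (lookup r₁ j <_) (sym (end-bottom a b x y)) (lower-< j)
    apart : ∀ i j → lookup r₀ i ≢ lookup r₁′ j
    apart i zero    = <⇒≢ (bump (upper-≥ i)) ∘ sym
    apart i (suc j) = disjoint i j
    cover : ∀ v → a + b ≤ v → v < a + b + (x + suc y) → Occurs r₀ r₁′ v
    cover v lo hi with m≤n⇒m<n∨m≡n lo
    ... | inj₂ n≡v = inj₂ (zero , n≡v)
    ... | inj₁ n<v with covers v (subst (_≤ v) (sym (+-suc a b)) n<v) (subst (v <_) (end-bottom a b x y) hi)
    ...   | inj₁ found   = inj₁ found
    ...   | inj₂ (j , e) = inj₂ (suc j , e)
    column : ∀ j → T (restricted (b + toℕ j)) →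
             b + toℕ j < a ⊎ ∃[ i ] (a + toℕ i ≡ b + toℕ j × lookup r₀ i < lookup r₁′ j)
    column zero    r = inj₁ (subst (_< a) (sym (+-identityʳ b))
                                   (allowed⇒late ok (subst (T ∘ restricted) (+-identityʳ b) r)))
    column (suc j) r with columns j (subst (T ∘ restricted) (+-suc b (toℕ j)) r)
    ... | inj₁ lt              = inj₁ (subst (_< a) (sym (+-suc b (toℕ j))) lt)
    ... | inj₂ (i , same , lt) = inj₂ (i , trans same (sym (+-suc b (toℕ j))) , lt)

  Fill⇒IsFillingFrom : Fill a b r₀ r₁ → IsFillingFrom a b r₀ r₁
  Fill⇒IsFillingFrom {a} {b} done = IsFillingFrom-[] a b
  Fill⇒IsFillingFrom (top p)       = IsFillingFrom-top (Fill⇒IsFillingFrom p)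
  Fill⇒IsFillingFrom (bottom ok p) = IsFillingFrom-bottom ok (Fill⇒IsFillingFrom p)

  IsFillingFrom-top⁻¹ : ∀ {a b x y} {r₀ : Vec ℕ x} {r₁ : Vec ℕ y} →
    IsFillingFrom a b ((a + b) ∷ r₀) r₁ → IsFillingFrom (suc a) b r₀ r₁
  IsFillingFrom-top⁻¹ {a} {b} {x} {y} {r₀} {r₁} F = record
    { upper-incr = λ i j i<j → upper-incr (suc i) (suc j) (s≤s i<j) ; lower-incr = lower-incr
    ; upper-≥ = λ i → upper-incr zero (suc i) z<s
    ; lower-≥ = λ j → ≤∧≢⇒< (lower-≥ j) (disjoint zero j)
    ; upper-< = λ i → subst (lookup r₀ i <_) (end-top a b x y) (upper-< (suc i))
    ; lower-< = λ j → subst (lookup r₁ j <_) (end-top a b x y) (lower-< j)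
    ; disjoint = λ i → disjoint (suc i) ; covers = cover ; columns = column }
    where
    open IsFillingFrom F
    cover : ∀ v → suc a + b ≤ v → v < suc a + b + (x + y) → Occurs r₀ r₁ v
    cover v lo hi with covers v (<⇒≤ lo) (subst (v <_) (sym (end-top a b x y)) hi)
    ... | inj₁ (zero  , n≡v) = ⊥-elim (<⇒≢ lo n≡v)
    ... | inj₁ (suc i , e)   = inj₁ (i , e)
    ... | inj₂ found         = inj₂ found
    column : ∀ j → T (restricted (b + toℕ j)) →
             b + toℕ j < suc a ⊎ ∃[ i ] (suc a + toℕ i ≡ b + toℕ j × lookup r₀ i < lookup r₁ j)
    column j r with columns j r
    ... | inj₁ lt                  = inj₁ (m<n⇒m<1+n lt)
    ... | inj₂ (zero  , same , _)  = inj₁ (s≤s (≤-reflexive (trans (sym same) (+-identityʳ a))))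
    ... | inj₂ (suc i , same , lt) = inj₂ (i , trans (sym (+-suc a (toℕ i))) same , lt)

  IsFillingFrom-bottom⁻¹ : ∀ {a b x y} {r₀ : Vec ℕ x} {r₁ : Vec ℕ y} →
    IsFillingFrom a b r₀ ((a + b) ∷ r₁) → IsFillingFrom a (suc b) r₀ r₁
  IsFillingFrom-bottom⁻¹ {a} {b} {x} {y} {r₀} {r₁} F = record
    { upper-incr = upper-incr ; lower-incr = λ i j i<j → lower-incr (suc i) (suc j) (s≤s i<j)
    ; upper-≥ = λ i → unbump (≤∧≢⇒< (upper-≥ i) (λ e → disjoint i zero (sym e)))
    ; lower-≥ = λ j → unbump (lower-incr zero (suc j) z<s)
    ; upper-< = λ i → subst (lookup r₀ i <_) (end-bottom a b x y) (upper-< i)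
    ; lower-< = λ j → subst (lookup r₁ j <_) (end-bottom a b x y) (lower-< (suc j))
    ; disjoint = λ i j → disjoint i (suc j) ; covers = cover ; columns = column }
    where
    open IsFillingFrom F
    unbump : ∀ {z} → a + b < z → a + suc b ≤ z
    unbump {z} = subst (_≤ z) (sym (+-suc a b))
    cover : ∀ v → a + suc b ≤ v → v < a + suc b + (x + y) → Occurs r₀ r₁ v
    cover v lo hi with covers v (<⇒≤ (bump lo)) (subst (v <_) (sym (end-bottom a b x y)) hi)
    ... | inj₁ found         = inj₁ found
    ... | inj₂ (zero  , n≡v) = ⊥-elim (<⇒≢ (bump lo) n≡v)
    ... | inj₂ (suc j , e)   = inj₂ (j , e)
    column : ∀ j → T (restricted (suc b + toℕ j)) →
             suc b + toℕ j < a ⊎ ∃[ i ] (a + toℕ i ≡ suc b + toℕ j × lookup r₀ i < lookup r₁ j)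
    column j r with columns (suc j) (subst (T ∘ restricted) (sym (+-suc b (toℕ j))) r)
    ... | inj₁ lt              = inj₁ (subst (_< a) (+-suc b (toℕ j)) lt)
    ... | inj₂ (i , same , lt) = inj₂ (i , trans same (+-suc b (toℕ j)) , lt)

  IsFillingFrom-allowed : IsFillingFrom a b r₀ ((a + b) ∷ r₁) → T (allowed a b)
  IsFillingFrom-allowed {a = a} {b = b} F = late⇒allowed late
    where
    open IsFillingFrom F
    late : T (restricted b) → b < a
    late r with columns zero (subst (T ∘ restricted) (sym (+-identityʳ b)) r)
    ... | inj₁ lt             = subst (_< a) (+-identityʳ b) lt
    ... | inj₂ (i , _ , a+b>) = ⊥-elim (<⇒≱ a+b> (upper-≥ i))

  private
    least-is-head : ∀ {k lo} (r : Vec ℕ (suc k)) → (∀ i j → i <ᶠ j → lookup r i < lookup r j) →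
                    (∀ i → lo ≤ lookup r i) → ∀ i → lookup r i ≡ lo → lookup r zero ≡ lo
    least-is-head r incr ≥lo zero    e = e
    least-is-head r incr ≥lo (suc i) e =
      ⊥-elim (<⇒≱ (subst (lookup r zero <_) e (incr zero (suc i) z<s)) (≥lo zero))

  IsFillingFrom⇒Fill : ∀ {a b x y} {r₀ : Vec ℕ x} {r₁ : Vec ℕ y} →
    IsFillingFrom a b r₀ r₁ → Fill a b r₀ r₁
  nextValue⇒Fill : ∀ {a b x y} {r₀ : Vec ℕ x} {r₁ : Vec ℕ y} →
    IsFillingFrom a b r₀ r₁ → 0 < x + y → Fill a b r₀ r₁
  topNext⇒Fill : IsFillingFrom a b r₀ r₁ → ∀ i → lookup r₀ i ≡ a + b → Fill a b r₀ r₁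
  bottomNext⇒Fill : IsFillingFrom a b r₀ r₁ → ∀ j → lookup r₁ j ≡ a + b → Fill a b r₀ r₁

  IsFillingFrom⇒Fill {x = zero}  {zero}  {[]} {[]} F = done
  IsFillingFrom⇒Fill {x = suc _}                   F = nextValue⇒Fill F z<s
  IsFillingFrom⇒Fill {x = zero}  {suc _}           F = nextValue⇒Fill F z<s

  nextValue⇒Fill {a} {b} F 0<x+y with IsFillingFrom.covers F (a + b) ≤-refl (m<m+n (a + b) 0<x+y)
  ... | inj₁ (i , e) = topNext⇒Fill F i e
  ... | inj₂ (j , e) = bottomNext⇒Fill F j e

  topNext⇒Fill {r₀ = h ∷ r₀} F i e
    with least-is-head (h ∷ r₀) (IsFillingFrom.upper-incr F) (IsFillingFrom.upper-≥ F) i e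
  ... | refl = top (IsFillingFrom⇒Fill (IsFillingFrom-top⁻¹ F))

  bottomNext⇒Fill {r₁ = h ∷ r₁} F j e
    with least-is-head (h ∷ r₁) (IsFillingFrom.lower-incr F) (IsFillingFrom.lower-≥ F) j e
  ... | refl = bottom (IsFillingFrom-allowed F) (IsFillingFrom⇒Fill (IsFillingFrom-bottom⁻¹ F))

private
  ∸-by : ∀ {a} b {c} → a ≡ b + c → a ∸ b ≡ c
  ∸-by b {c} refl = m+n∸m≡n b c

  level-identity : ∀ m₀ j d → suc (suc j + d) * suc m₀ ≡ suc (suc j * suc m₀) + (d + m₀ * suc d)
  level-identity = solve 3 (λ m j d → (con 2 :+ j :+ d) :* (con 1 :+ m) :=
                                       (con 1 :+ (con 1 :+ j) :* (con 1 :+ m)) :+ (d :+ m :* (con 1 :+ d))) refl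

  column-identity : ∀ r e j d t → suc (j + d) * suc (r + e) + suc t ≡
                                  (suc (j * suc (r + e)) + r) + (e + d * suc (r + e) + suc t)
  column-identity = solve 5 (λ r e j d t → (con 1 :+ (j :+ d)) :* (con 1 :+ (r :+ e)) :+ (con 1 :+ t) :=
    (con 1 :+ j :* (con 1 :+ (r :+ e)) :+ r) :+ (e :+ d :* (con 1 :+ (r :+ e)) :+ (con 1 :+ t))) refl

  total-identity : ∀ r e d t → 2 * suc (r + e) * suc d + suc t ≡
                               (suc r + 1) + ((e + d * suc (r + e) + suc t) + (d + (r + e) * suc d))
  total-identity = solve 4 (λ r e d t → con 2 :* (con 1 :+ (r :+ e)) :* (con 1 :+ d) :+ (con 1 :+ t) :=
    (con 1 :+ r :+ con 1) :+ ((e :+ d :* (con 1 :+ (r :+ e)) :+ (con 1 :+ t))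
                              :+ (d :+ (r :+ e) :* (con 1 :+ d)))) refl

  double-identity : ∀ m₀ i → 2 * suc m₀ * suc i ≡ suc m₀ + (i * suc m₀ + suc i * suc m₀)
  double-identity = solve 2 (λ m i → con 2 :* (con 1 :+ m) :* (con 1 :+ i) :=
                                      (con 1 :+ m) :+ (i :* (con 1 :+ m) :+ (con 1 :+ i) :* (con 1 :+ m))) refl

-- Writing i = suc (j + d) and m₀ = r + e makes every truncated subtraction exact.

binomial-bottom : ∀ m₀ {i j} → j < i →
                  suc m₀ * (suc i ∸ suc j) ∸ 1 ≡ suc i * suc m₀ ∸ suc (suc j * suc m₀)
binomial-bottom m₀ {i} {j} j<i with i ∸ suc j | m+[n∸m]≡n j<i
... | d | refl rewrite ∸-by j (sym (+-suc j d)) = sym (∸-by (suc (suc j * suc m₀)) (level-identity m₀ j d))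

binomial-top : ∀ m₀ t {i j r} → j < i → r < suc m₀ →
  (2 * suc m₀ * (suc i ∸ suc j) + suc t) ∸ suc r ∸ 1 ≡
  ((i * suc m₀ + suc t) ∸ (suc (j * suc m₀) + r)) + (suc i * suc m₀ ∸ suc (suc j * suc m₀))
binomial-top m₀ t {i} {j} {r} j<i r<m
  with i ∸ suc j | m+[n∸m]≡n j<i | m₀ ∸ r | m+[n∸m]≡n (≤-pred r<m)
... | d | refl | e | refl
  rewrite ∸-by j (sym (+-suc j d))
        | ∸-+-assoc (2 * suc (r + e) * suc d + suc t) (suc r) 1
        | ∸-by (suc (j * suc (r + e)) + r) (column-identity r e j d t)
        | ∸-by (suc (suc j * suc (r + e))) (level-identity (r + e) j d)
  = ∸-by (suc r + 1) (total-identity r e d t)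

gTop : ∀ m₀ i t → (2 * suc m₀ * suc i ∸ suc m₀) + suc t ∸ 1 ≡ (i * suc m₀ + t) + suc i * suc m₀
gTop m₀ i t rewrite ∸-by (suc m₀) (double-identity m₀ i) | +-suc (i * suc m₀ + suc i * suc m₀) t =
  xy∙z≈xz∙y (i * suc m₀) (suc i * suc m₀) t

gTop₁ : ∀ m₀ t → suc m₀ + suc t ∸ 1 ≡ t + (suc m₀ + 0)
gTop₁ m₀ t rewrite +-suc m₀ t | +-identityʳ m₀ = trans (cong suc (+-comm m₀ t)) (sym (+-suc t m₀))

fbarTop : ∀ m₀ n → 2 * suc m₀ * suc n ∸ 1 ≡ (n * suc m₀ + m₀) + suc n * suc m₀
fbarTop m₀ n =
  ∸-by 1 (trans (double-identity m₀ n) (cong suc (x∙yz≈yx∙z m₀ (n * suc m₀) (suc n * suc m₀))))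

Σ1≡sum< : ∀ k (f : ℕ → ℤ) (h : ℕ → ℕ) → (∀ j → j < k → f (suc j) ≡ + h j) → Σ1 k f ≡ + sum< k h
Σ1≡sum< zero    f h f≡h = refl
Σ1≡sum< (suc k) f h f≡h =
  trans (cong₂ ℤ._+_ (Σ1≡sum< k f h (λ j j<k → f≡h j (m<n⇒m<1+n j<k))) (f≡h k ≤-refl))
        (sym (ℤ.pos-+ (sum< k h) (h k)))

+-as-difference : ∀ {a b c} → b ≡ a + c → + a ≡ + b ℤ.- + c
+-as-difference {a} {c = c} refl = sym (begin
  + (a + c) ℤ.- + c ≡⟨ ℤ.[+m]-[+n]≡m⊖n (a + c) c ⟩
  (a + c) ℤ.⊖ c     ≡⟨ ℤ.⊖-≥ (m≤n+m c a) ⟩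
  + (a + c ∸ c)     ≡⟨ cong +_ (m+n∸n≡m a c) ⟩
  + a               ∎)
  where open ≡-Reasoning

Cℤ≡allPaths : ∀ {a b u w} → a ≡ u + w → b ≡ w → Cℤ a b ≡ + allPaths u w
Cℤ≡allPaths {u = u} {w} refl refl = cong +_ (sym (allPaths≡C u w))

g-unfold : ∀ m i t → g m t (suc i) ≡ gStep m (suc i) (gUpTo m i) t
g-unfold m i t with i ≡ᵇ i | ≡⇒≡ᵇ i i refl
... | true | _ = refl

gUpTo-agrees : ∀ m k {j} r → 1 ≤ j → j ≤ k → gUpTo m k r j ≡ g m r j
gUpTo-agrees m (suc k) {j} r 1≤j j≤1+k with m≤n⇒m<n∨m≡n j≤1+k
... | inj₂ refl = refl
... | inj₁ j<1+k with j ≡ᵇ suc k | ≡ᵇ⇒≡ j (suc k)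
...   | true  | j≡1+k = ⊥-elim (<⇒≢ j<1+k (j≡1+k _))
...   | false | _     = gUpTo-agrees m k r 1≤j (≤-pred j<1+k)
gUpTo-agrees m zero r (s≤s _) ()

module Periodic (m₀ : ℕ) where

  m : ℕ
  m = suc m₀

  -- Column c is the paper's column c + 1, and the non-free columns are the columns jm + 1.
  restricted : ℕ → Bool
  restricted c = c % m ≡ᵇ 0

  open RestrictedColumns restricted

  restricted-multiple : ∀ j → T (restricted (j * m))
  restricted-multiple j = ≡⇒≡ᵇ _ 0 (m*n%n≡0 j m)

  offset-% : ∀ j {k} → k < m → (j * m + k) % m ≡ k
  offset-% j {k} k<m = begin
    (j * m + k) % m ≡⟨ cong (_% m) (+-comm (j * m) k) ⟩
    (k + j * m) % m ≡⟨ [m+kn]%n≡m%n k j m ⟩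
    k % m           ≡⟨ m<n⇒m%n≡m k<m ⟩
    k               ∎

  unrestricted : ∀ j {k} → k < m₀ → restricted (j * m + suc k) ≡ false
  unrestricted j k<m₀ rewrite offset-% j (s≤s k<m₀) = refl

  blocked-unrestricted : ∀ a j {k} → k < m₀ → blocked a (j * m + suc k) ≡ 0
  blocked-unrestricted a j {k} k<m₀ =
    blocked-allowed {a} {j * m + suc k} (allowed-unrestricted a (unrestricted j k<m₀))

  blocked-early : ∀ a j → a ≤ j * m → blocked a (suc j * m) ≡ 0
  blocked-early a j a≤jm =
    trans (cong (χ _) (good-unreachable (restricted-multiple j) a (suc j * m) jm<[1+j]m a≤jm)) (χ-zero _)
    where
    jm<[1+j]m : j * m < suc j * m
    jm<[1+j]m = s≤s (m≤n+m (j * m) m₀)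

  blocked-level : ∀ j {r} → r < m →
                  blocked (suc (j * m) + r) (suc j * m) ≡ good (suc (j * m) + r) (suc j * m)
  blocked-level j {r} r<m = blocked-forbidden (restricted-multiple (suc j))
    (subst₂ _≤_ (+-suc (j * m) r) (+-comm (j * m) m) (+-monoʳ-≤ (j * m) r<m))

  blocked-late : ∀ {a} j → suc j * m < a → blocked a (suc j * m) ≡ 0
  blocked-late {a} j b<a = blocked-allowed {a} {suc j * m} (allowed-late b<a)

  levelSum : ℕ → (ℕ → ℕ → ℕ) → ℕ → ℕ
  levelSum n K b = sum< n (λ a → blocked a b * K a b)

  -- blocked a 0 computes to 1 for a = 0 and to 0 for a > 0.
  levelSum-zero : ∀ n K → levelSum (suc n) K 0 ≡ K 0 0
  levelSum-zero n K = begin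
    levelSum (suc n) K 0         ≡⟨ sum<-suc n _ ⟩
    1 * K 0 0 + sum< n (λ _ → 0) ≡⟨ cong (_+_ (1 * K 0 0)) (sum<-zero n (λ _ _ → refl)) ⟩
    1 * K 0 0 + 0                ≡⟨ +-identityʳ _ ⟩
    1 * K 0 0                    ≡⟨ *-identityˡ _ ⟩
    K 0 0                        ∎

  levelSum-unrestricted : ∀ n K j →
    sum< m (λ k → levelSum n K (j * m + k)) ≡ levelSum n K (j * m + 0)
  levelSum-unrestricted n K j = begin
    sum< m (λ k → levelSum n K (j * m + k))
      ≡⟨ sum<-suc m₀ _ ⟩
    levelSum n K (j * m + 0) + sum< m₀ (λ k → levelSum n K (j * m + suc k))
      ≡⟨ cong (_+_ (levelSum n K (j * m + 0))) (sum<-zero m₀ (λ k k<m₀ →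
           sum<-zero n (λ a _ → cong (_* K a (j * m + suc k)) (blocked-unrestricted a j k<m₀)))) ⟩
    levelSum n K (j * m + 0) + 0
      ≡⟨ +-identityʳ _ ⟩
    levelSum n K (j * m + 0) ∎

  levelSum-multiple : ∀ j L K → levelSum (suc (j * m) + (m + L)) K (suc j * m) ≡
                      sum< m (λ r → good (suc (j * m) + r) (suc j * m) * K (suc (j * m) + r) (suc j * m))
  levelSum-multiple j L K = begin
    sum< (a₀ + (m + L)) (λ a → blocked a b * K a b)
      ≡⟨ sum<-++ a₀ (m + L) _ ⟩
    sum< a₀ (λ a → blocked a b * K a b) + sum< (m + L) (λ r → blocked (a₀ + r) b * K (a₀ + r) b)
      ≡⟨ cong₂ _+_ (sum<-zero a₀ (λ a a≤jm → cong (_* K a b) (blocked-early a j (≤-pred a≤jm))))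
                   (sum<-++ m L _) ⟩
    0 + (sum< m (λ r → blocked (a₀ + r) b * K (a₀ + r) b)
         + sum< L (λ r → blocked (a₀ + (m + r)) b * K (a₀ + (m + r)) b))
      ≡⟨ cong₂ _+_ (sum<-cong m (λ r r<m → cong (_* K (a₀ + r) b) (blocked-level j r<m)))
                   (sum<-zero L (λ r _ → cong (_* K (a₀ + (m + r)) b) (blocked-late j (late r)))) ⟩
    sum< m (λ r → good (a₀ + r) b * K (a₀ + r) b) + 0
      ≡⟨ +-identityʳ _ ⟩
    sum< m (λ r → good (a₀ + r) b * K (a₀ + r) b) ∎
    where
    a₀ b : ℕ
    a₀ = suc (j * m)
    b  = suc j * m
    late : ∀ r → b < a₀ + (m + r)
    late r = s≤s (subst (_≤ j * m + (m + r)) (+-comm (j * m) m) (+-monoʳ-≤ (j * m) (m≤m+n m r)))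

  blockTerm : ℕ → ℕ → ℕ → ℕ → ℕ
  blockTerm i t j r =
    good (suc (j * m) + r) (suc j * m) * allPaths ((i * m + suc t) ∸ (suc (j * m) + r)) (suc i * m ∸ suc (suc j * m))

  blockViolations : ℕ → ℕ → ℕ
  blockViolations i t = sum< i (λ j → sum< m (blockTerm i t j))

  violations-periodic : ∀ i t → violations (i * m + suc t) (suc i * m) ≡
                        allPaths (i * m + suc t) (suc i * m ∸ 1) + blockViolations i t
  violations-periodic i t = begin
    sum< (suc X) (λ a → sum< Y (λ b → blocked a b * K a b))
      ≡⟨ sum<-comm (suc X) Y (λ a b → blocked a b * K a b) ⟩
    sum< Y (levelSum (suc X) K)
      ≡⟨ sum<-* (suc i) m (levelSum (suc X) K) ⟩
    sum< (suc i) (λ j → sum< m (λ k → levelSum (suc X) K (j * m + k)))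
      ≡⟨ sum<-cong (suc i) (λ j _ → levelSum-unrestricted (suc X) K j) ⟩
    sum< (suc i) (λ j → levelSum (suc X) K (j * m + 0))
      ≡⟨ sum<-suc i _ ⟩
    levelSum (suc X) K 0 + sum< i (λ j → levelSum (suc X) K (suc j * m + 0))
      ≡⟨ cong₂ _+_ (levelSum-zero X K) (sum<-cong i atMultiple) ⟩
    allPaths X (Y ∸ 1) + blockViolations i t ∎
    where
    X Y : ℕ
    X = i * m + suc t
    Y = suc i * m
    K : ℕ → ℕ → ℕ
    K a b = allPaths (X ∸ a) (Y ∸ suc b)
    atMultiple : ∀ j → j < i → levelSum (suc X) K (suc j * m + 0) ≡
                 sum< m (λ r → good (suc (j * m) + r) (suc j * m) * K (suc (j * m) + r) (suc j * m))
    atMultiple j j<i = begin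
      levelSum (suc X) K (suc j * m + 0)
        ≡⟨ cong (levelSum (suc X) K) (+-identityʳ (suc j * m)) ⟩
      levelSum (suc X) K (suc j * m)
        ≡⟨ cong (λ n → levelSum n K (suc j * m)) split ⟩
      levelSum (suc (j * m) + (m + (X ∸ (m + j * m)))) K (suc j * m)
        ≡⟨ levelSum-multiple j (X ∸ (m + j * m)) K ⟩
      sum< m (λ r → good (suc (j * m) + r) (suc j * m) * K (suc (j * m) + r) (suc j * m)) ∎
      where
      [1+j]m≤X : m + j * m ≤ X
      [1+j]m≤X = ≤-trans (*-monoˡ-≤ m j<i) (m≤m+n (i * m) (suc t))
      split : suc X ≡ suc (j * m) + (m + (X ∸ (m + j * m)))
      split = cong suc (begin
        X                                 ≡⟨ m+[n∸m]≡n [1+j]m≤X ⟨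
        (m + j * m) + (X ∸ (m + j * m))   ≡⟨ cong (_+ (X ∸ (m + j * m))) (+-comm m (j * m)) ⟩
        (j * m + m) + (X ∸ (m + j * m))   ≡⟨ +-assoc (j * m) m _ ⟩
        j * m + (m + (X ∸ (m + j * m)))   ∎)

  -- Pascal's rule absorbs the term allPaths X (Y ∸ 1) of the first forbidden step (0, 0) → (0, 1).
  allPaths-periodic : ∀ i t → allPaths (i * m + t) (suc i * m) ≡
                      good (i * m + suc t) (suc i * m) + blockViolations i t
  allPaths-periodic i t = +-cancelʳ-≡ (allPaths X (m₀ + i * m)) _ _ (begin
    allPaths (i * m + t) (suc i * m) + allPaths X (m₀ + i * m)
      ≡⟨ cong (λ x → allPaths (i * m + t) (suc i * m) + allPaths x (m₀ + i * m)) (+-suc (i * m) t) ⟩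
    allPaths (suc (i * m + t)) (suc i * m)
      ≡⟨ cong (λ x → allPaths x (suc i * m)) (+-suc (i * m) t) ⟨
    allPaths X (suc i * m)
      ≡⟨ allPaths≡good+violations X (suc i * m) ⟩
    good X (suc i * m) + violations X (suc i * m)
      ≡⟨ cong (_+_ (good X (suc i * m))) (violations-periodic i t) ⟩
    good X (suc i * m) + (allPaths X (m₀ + i * m) + blockViolations i t)
      ≡⟨ x∙yz≈xz∙y (good X (suc i * m)) _ _ ⟩
    (good X (suc i * m) + blockViolations i t) + allPaths X (m₀ + i * m) ∎)
    where
    X : ℕ
    X = i * m + suc t

  earlierTerms : ℕ → ℕ → (ℕ → ℕ → ℤ) → ℤ
  earlierTerms i t G = Σ1 i (λ j → Σ1 m (λ r →
    G r j ℤ.* Cℤ ((2 * m * (suc i ∸ j) + t) ∸ r ∸ 1) (m * (suc i ∸ j) ∸ 1)))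

  AgreesBelow : ℕ → (ℕ → ℕ → ℤ) → Set
  AgreesBelow i G = ∀ j → j < i → ∀ r → r < m → G (suc r) (suc j) ≡ + good (j * m + suc r) (suc j * m)

  earlierTerms≡blockViolations : ∀ i t G → AgreesBelow i G →
                                 earlierTerms i (suc t) G ≡ + blockViolations i t
  earlierTerms≡blockViolations i t G G≡good =
    Σ1≡sum< i _ (λ j → sum< m (blockTerm i t j)) λ j j<i → Σ1≡sum< m _ (blockTerm i t j) λ r r<m → begin
      G (suc r) (suc j) ℤ.* Cℤ ((2 * m * (suc i ∸ suc j) + suc t) ∸ suc r ∸ 1) (m * (suc i ∸ suc j) ∸ 1)
        ≡⟨ cong₂ ℤ._*_ (trans (G≡good j j<i r r<m) (cong (λ a → + good a (suc j * m)) (+-suc (j * m) r)))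
                       (Cℤ≡allPaths (binomial-top m₀ t j<i r<m) (binomial-bottom m₀ j<i)) ⟩
      + good (suc (j * m) + r) (suc j * m)
        ℤ.* + allPaths ((i * m + suc t) ∸ (suc (j * m) + r)) (suc i * m ∸ suc (suc j * m))
        ≡⟨ ℤ.pos-* (good (suc (j * m) + r) (suc j * m)) _ ⟨
      + blockTerm i t j r ∎

  recurrence≡good : ∀ i t {top} → top ≡ (i * m + t) + suc i * m → ∀ G → AgreesBelow i G →
    Cℤ top (m * suc i) ℤ.- earlierTerms i (suc t) G ≡ + good (i * m + suc t) (suc i * m)
  recurrence≡good i t {top} top≡ G G≡good = begin
    Cℤ top (m * suc i) ℤ.- earlierTerms i (suc t) G
      ≡⟨ cong₂ ℤ._-_ (Cℤ≡allPaths top≡ (*-comm m (suc i)))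
                     (earlierTerms≡blockViolations i t G G≡good) ⟩
    + allPaths (i * m + t) (suc i * m) ℤ.- + blockViolations i t
      ≡⟨ +-as-difference (allPaths-periodic i t) ⟨
    + good (i * m + suc t) (suc i * m) ∎

  gCountsGood : ℕ → Set
  gCountsGood i = ∀ t → t < m → g m (suc t) (suc i) ≡ + good (i * m + suc t) (suc i * m)

  g≡good : ∀ i → gCountsGood i
  g≡good = <-rec gCountsGood step
    where
    step : ∀ i → (∀ {j} → j < i → gCountsGood j) → gCountsGood i
    step zero    _  t _ = begin
      g m (suc t) 1                          ≡⟨ g-unfold m 0 (suc t) ⟩
      Cℤ (m + suc t ∸ 1) m                   ≡⟨ Cℤ≡allPaths (gTop₁ m₀ t) (sym (+-identityʳ m)) ⟩
      + allPaths t (m + 0)                   ≡⟨ cong +_ (allPaths-periodic 0 t) ⟩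
      + (good (suc t) (m + 0) + 0)           ≡⟨ cong +_ (+-identityʳ _) ⟩
      + good (suc t) (m + 0)                 ∎
    step (suc i) IH t _ = trans (g-unfold m (suc i) (suc t))
      (recurrence≡good (suc i) t (gTop m₀ (suc i) t) (gUpTo m (suc i))
        (λ j j<i r r<m → trans (gUpTo-agrees m (suc i) (suc r) (s≤s z≤n) j<i) (IH j<i r r<m)))

  fbarFormula≡good : ∀ n → fbarFormula m (suc n) ≡ + good (n * m + m) (suc n * m)
  fbarFormula≡good n = recurrence≡good n m₀ (fbarTop m₀ n) (g m) (λ j _ r r<m → g≡good j r r<m)

  module Fillings (n : ℕ) where
    open PathEncoding restricted

    N : ℕ
    N = m * n

    free⇒unrestricted : ∀ (c : Fin N) → FreeColumn m n c → ¬ T (restricted (toℕ c))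
    free⇒unrestricted c (j , suc (suc k) , _ , s≤s (s≤s _) , s≤s k<m₀ , 1+c≡) r =
      0≢1+n (trans (sym (≡ᵇ⇒≡ _ 0 (subst (T ∘ restricted) c≡ r))) (offset-% j (s≤s k<m₀)))
      where
      c≡ : toℕ c ≡ j * m + suc k
      c≡ = suc-injective (trans 1+c≡ (+-suc (j * m) (suc k)))

    unrestricted⇒free : ∀ (c : Fin N) → ¬ T (restricted (toℕ c)) → FreeColumn m n c
    unrestricted⇒free c ¬r =
      toℕ c / m , suc (toℕ c % m) , m<n*o⇒m/o<n (subst (toℕ c <_) (*-comm m n) (toℕ<n c)) ,
      s≤s (n≢0⇒n>0 (¬r ∘ ≡⇒≡ᵇ _ 0)) , m%n<n (toℕ c) m , 1+c≡
      where
      1+c≡ : suc (toℕ c) ≡ toℕ c / m * m + suc (toℕ c % m)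
      1+c≡ = trans (cong suc (trans (m≡m%n+[m/n]*n (toℕ c) m) (+-comm (toℕ c % m) _))) (sym (+-suc _ _))

    nonfree⇒restricted : ∀ (c : Fin N) → ¬ FreeColumn m n c → T (restricted (toℕ c))
    nonfree⇒restricted c ¬free = decidable-stable (T? _) (¬free ∘ unrestricted⇒free c)

    private
      2N≡ : 0 + 0 + (N + N) ≡ 2 * N
      2N≡ = cong (_+_ N) (sym (+-identityʳ N))

    module _ (tab : Table m n) (r₀ r₁ : Vec ℕ N)
             (r₀≡ : ∀ c → toℕ (entry m n tab zero c) ≡ lookup r₀ c)
             (r₁≡ : ∀ c → toℕ (entry m n tab (suc zero) c) ≡ lookup r₁ c) where

      IsFilling⇒IsFillingFrom : IsFilling m n tab → IsFillingFrom 0 0 r₀ r₁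
      IsFilling⇒IsFillingFrom F = record
        { upper-incr = λ i j i<j → subst₂ _<_ (r₀≡ i) (r₀≡ j) (rowsIncr zero i j i<j)
        ; lower-incr = λ i j i<j → subst₂ _<_ (r₁≡ i) (r₁≡ j) (rowsIncr (suc zero) i j i<j)
        ; upper-≥ = λ _ → z≤n ; lower-≥ = λ _ → z≤n
        ; upper-< = λ i → subst₂ _<_ (r₀≡ i) (sym 2N≡) (toℕ<n (entry m n tab zero i))
        ; lower-< = λ i → subst₂ _<_ (r₁≡ i) (sym 2N≡) (toℕ<n (entry m n tab (suc zero) i))
        ; disjoint = apart ; covers = cover ; columns = column }
        where
        open IsFilling F
        apart : ∀ i j → lookup r₀ i ≢ lookup r₁ j
        apart i j e =
          0≢1+nᶠ (proj₁ (injective zero i (suc zero) j (toℕ-injective (trans (r₀≡ i) (trans e (sym (r₁≡ j)))))))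
        cover : ∀ v → 0 ≤ v → v < 0 + 0 + (N + N) → Occurs r₀ r₁ v
        cover v _ v< with surjective (fromℕ< (subst (v <_) 2N≡ v<))
        ... | zero     , i , e = inj₁ (i , trans (sym (r₀≡ i)) (trans (cong toℕ e) (toℕ-fromℕ< _)))
        ... | suc zero , i , e = inj₂ (i , trans (sym (r₁≡ i)) (trans (cong toℕ e) (toℕ-fromℕ< _)))
        column : ∀ j → T (restricted (toℕ j)) →
                 toℕ j < 0 ⊎ ∃[ i ] (toℕ i ≡ toℕ j × lookup r₀ i < lookup r₁ j)
        column j r =
          inj₂ (j , refl , subst₂ _<_ (r₀≡ j) (r₁≡ j) (columns j (λ free → free⇒unrestricted j free r)))

      IsFillingFrom⇒IsFilling : IsFillingFrom 0 0 r₀ r₁ → IsFilling m n tab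
      IsFillingFrom⇒IsFilling F =
        record { injective = inj ; surjective = surj ; rowsIncr = incr ; columns = column }
        where
        open IsFillingFrom F
        incr : ∀ r c c′ → c <ᶠ c′ → entry m n tab r c <ᶠ entry m n tab r c′
        incr zero       c c′ c<c′ = subst₂ _<_ (sym (r₀≡ c)) (sym (r₀≡ c′)) (upper-incr c c′ c<c′)
        incr (suc zero) c c′ c<c′ = subst₂ _<_ (sym (r₁≡ c)) (sym (r₁≡ c′)) (lower-incr c c′ c<c′)
        sameRow : ∀ r c c′ → entry m n tab r c ≡ entry m n tab r c′ → c ≡ c′
        sameRow r c c′ e with <-cmpᶠ c c′
        ... | tri< c<c′ _ _ = ⊥-elim (<⇒≢ (incr r c c′ c<c′) (cong toℕ e))
        ... | tri≈ _ c≡c′ _ = c≡c′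
        ... | tri> _ _ c>c′ = ⊥-elim (<⇒≢ (incr r c′ c c>c′) (cong toℕ (sym e)))
        apart : ∀ c c′ → entry m n tab zero c ≢ entry m n tab (suc zero) c′
        apart c c′ e = disjoint c c′ (trans (sym (r₀≡ c)) (trans (cong toℕ e) (r₁≡ c′)))
        inj : ∀ r c r′ c′ → entry m n tab r c ≡ entry m n tab r′ c′ → r ≡ r′ × c ≡ c′
        inj zero       c zero       c′ e = refl , sameRow zero c c′ e
        inj (suc zero) c (suc zero) c′ e = refl , sameRow (suc zero) c c′ e
        inj zero       c (suc zero) c′ e = ⊥-elim (apart c c′ e)
        inj (suc zero) c zero       c′ e = ⊥-elim (apart c′ c (sym e))
        surj : ∀ x → ∃[ r ] ∃[ c ] entry m n tab r c ≡ x
        surj x with covers (toℕ x) z≤n (subst (toℕ x <_) (sym 2N≡) (toℕ<n x))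
        ... | inj₁ (i , e) = zero , i , toℕ-injective (trans (r₀≡ i) e)
        ... | inj₂ (j , e) = suc zero , j , toℕ-injective (trans (r₁≡ j) e)
        column : ∀ c → ¬ FreeColumn m n c → entry m n tab zero c <ᶠ entry m n tab (suc zero) c
        column c ¬free with columns c (nonfree⇒restricted c ¬free)
        ... | inj₂ (c′ , c′≡c , lt) with toℕ-injective {i = c′} {j = c} c′≡c
        ...   | refl = subst₂ _<_ (sym (r₀≡ c)) (sym (r₁≡ c)) lt

    private
      toFin : (r : Vec ℕ N) → .(∀ i → lookup r i < 2 * N) → Vec (Fin (2 * N)) N
      toFin r r< = tabulate (λ i → fromℕ< (r< i))

      toℕ-toFin : ∀ (r : Vec ℕ N) .(r< : ∀ i → lookup r i < 2 * N) c →
                  toℕ (lookup (toFin r r<) c) ≡ lookup r c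
      toℕ-toFin r r< c = trans (cong toℕ (lookup∘tabulate (λ i → fromℕ< (r< i)) c)) (toℕ-fromℕ< _)

      toℕ-lookup : ∀ (u : Vec (Fin (2 * N)) N) c → toℕ (lookup u c) ≡ lookup (map toℕ u) c
      toℕ-lookup u c = sym (lookup-map c toℕ u)

      upper< : ∀ {r₀ r₁ : Vec ℕ N} → Fill 0 0 r₀ r₁ → ∀ i → lookup r₀ i < 2 * N
      upper< {r₀} p i = subst (lookup r₀ i <_) 2N≡ (IsFillingFrom.upper-< (Fill⇒IsFillingFrom p) i)

      lower< : ∀ {r₀ r₁ : Vec ℕ N} → Fill 0 0 r₀ r₁ → ∀ i → lookup r₁ i < 2 * N
      lower< {r₁ = r₁} p i = subst (lookup r₁ i <_) 2N≡ (IsFillingFrom.lower-< (Fill⇒IsFillingFrom p) i)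

      filled-≡ : ∀ {u u′ v v′ : Vec ℕ N} .{p p′} → u ≡ u′ → v ≡ v′ →
                 filled {0} {0} u v p ≡ filled u′ v′ p′
      filled-≡ refl refl = refl

      filling-≡ : ∀ {t t′ : Table m n} .{p p′} → t ≡ t′ → filling {m} {n} t p ≡ filling t′ p′
      filling-≡ refl = refl

    Filling↔Filled : Filling m n ↔ Filled 0 0 N N
    Filling↔Filled = mk↔ₛ′ to from to∘from from∘to
      where
      to : Filling m n → Filled 0 0 N N
      to (filling tab valid) = filled (map toℕ u) (map toℕ v)
        (IsFillingFrom⇒Fill (IsFilling⇒IsFillingFrom tab _ _ (toℕ-lookup u) (toℕ-lookup v) valid))
        where
        u v : Vec (Fin (2 * N)) N
        u = lookup tab zero
        v = lookup tab (suc zero)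
      from : Filled 0 0 N N → Filling m n
      from (filled r₀ r₁ p) = filling (toFin r₀ (upper< p) ∷ toFin r₁ (lower< p) ∷ [])
        (IsFillingFrom⇒IsFilling _ r₀ r₁ (toℕ-toFin r₀ (upper< p)) (toℕ-toFin r₁ (lower< p))
                                 (Fill⇒IsFillingFrom p))
      to∘from : ∀ f → to (from f) ≡ f
      to∘from (filled r₀ r₁ p) = filled-≡ (toℕ∘toFin r₀ (upper< p)) (toℕ∘toFin r₁ (lower< p))
        where
        toℕ∘toFin : (r : Vec ℕ N) .(r< : ∀ i → lookup r i < 2 * N) → map toℕ (toFin r r<) ≡ r
        toℕ∘toFin r r< =
          Pointwise-≡⇒≡ (ext λ c → trans (sym (toℕ-lookup (toFin r r<) c)) (toℕ-toFin r r< c))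
      from∘to : ∀ f → from (to f) ≡ f
      from∘to (filling (u ∷ v ∷ []) _) =
        filling-≡ (cong₂ (λ u v → u ∷ v ∷ []) (toFin∘toℕ u _) (toFin∘toℕ v _))
        where
        toFin∘toℕ : (u : Vec (Fin (2 * N)) N) .(u< : ∀ i → lookup (map toℕ u) i < 2 * N) →
                    toFin (map toℕ u) u< ≡ u
        toFin∘toℕ u u< =
          Pointwise-≡⇒≡ (ext λ c → toℕ-injective (trans (toℕ-toFin (map toℕ u) u< c) (sym (toℕ-lookup u c))))

    Filling↔good : Filling m n ↔ Fin (good N N)
    Filling↔good = ↔-trans Filling↔Filled (Filled↔paths 0 0 N N)

proposition2p6 : (m n : ℕ) → 2 ≤ m → 1 ≤ n →
    Σ ℕ (λ k → HasCount (Filling m n) k × (+ k ≡ fbarFormula m n) × (g m m n ≡ + k))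
proposition2p6 (suc m₀) (suc n) (s≤s _) (s≤s _) =
  good N N , Filling↔good , sym (trans (fbarFormula≡good n) (cong +_ diagonal)) ,
  trans (g≡good n m₀ ≤-refl) (cong +_ diagonal)
  where
  open Periodic m₀
  open RestrictedColumns restricted
  open Fillings (suc n)
  diagonal : good (n * m + m) (suc n * m) ≡ good N N
  diagonal = cong₂ good (trans (+-comm (n * m) m) (*-comm (suc n) m)) (*-comm (suc n) m)
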